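{- In the following setting, consider the proof-producing variant of the Dutertre–de Moura simplex procedure for linear rational arithmetic. The input is a finite set of inequalities, each of the form $l_k \le t_k$ or $u_k \ge t_k$ with $t_k=\sum_h \hat a_{kh} y_h$ a linear term over rational variables $y_h$. For each distinct term $t_k$ a slack variable $s_k$ is introduced, each input inequality is replaced by the elementary atom $l_k\le s_k$ (resp. $u_k \ge s_k$), and the equation $s_k = t_k$ is added; initially the basic variables $\mathcal B$ are the slacks and the non-basic variables $\mathcal N$ are the $y_h$. The procedure maintains a tableau $\{x_i=\sum_{x_j\in\mathcal N} a_{ij}x_j\mid x_i\in\mathcal B\}$ having the same rational solutions as the initial equations, and an assignment $\beta$ with $\beta(x_i)=\sum_j a_{ij}\beta(x_j)$ for basic $x_i$. Suppose a conflict is reported from row $x_i=\sum_{x_j\in\mathcal N} a_{ij}x_j$ because of an elementary atom $x_i\ge l_i$ with $\beta(x_i)<l_i$, where, with $\mathcal N^+=\{x_j\mid a_{ij}>0\}$ and $\mathcal N^-=\{x_j\mid a_{ij}<0\}$, each $x_j\in\mathcal N^+$ has an elementary atom $x_j\le u_j$ with $\beta(x_j)=u_j$ and each $x_j\in\mathcal N^-$ has an elementary atom $x_j\ge l_j$ with $\beta(x_j)=l_j$. (Then $x_i$ and all these $x_j$ are slack variables.) Build the following linear combination of original input inequalities, each written in the form $0\le \cdot$: for each $x_j\in\mathcal N^+$, where $x_j$ is the slack of the term $t_k$, take the input atom $0\le u_k - t_k$ with coefficient $a_{ij}$; for each $x_j\in\mathcal N^-$, where $x_j$ is the slack of $t_k$,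 take the input atom $0\le t_k - l_k$ with coefficient $-a_{ij}$; finally take the input atom $0 \le t_k - l_k$ corresponding to $x_i$ with coefficient $1$; and sum them (by repeated applications of the rule that from $0\le t_1$ and $0\le t_2$ derives $0\le c_1t_1+c_2t_2$ for $c_1,c_2>0$). Then the result is an atom $0\le c$ where $c$ is a numerical constant strictly lower than zero. -}

module Defs where

open import Data.Nat using (ℕ; zero; suc)
open import Data.Fin using (Fin; zero; suc)
open import Data.Sum using (_⊎_; inj₁; inj₂)
open import Data.Bool using (Bool; true; false; if_then_else_)
open import Data.Product using (_×_; Σ; _,_)
open import Data.Rational using (ℚ; 0ℚ; _+_; _*_; -_; _<_; _-_)
open import Data.Rational.Properties using (_<?_)
open import Relation.Nullary using (does)
open import Relation.Binary.PropositionalEquality using (_≡_)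
open import Function.Bundles using (_⇔_)

∑ : {n : ℕ} → (Fin n → ℚ) → ℚ
∑ {zero}  f = 0ℚ
∑ {suc n} f = f zero + ∑ (λ i → f (suc i))

-- Problem data.
-- m : number of original rational variables y_h (h : Fin m)
-- K : number of distinct linear terms t_k (k : Fin K); t k h = â_{kh}
-- Variables of the tableau: inj₁ h = y_h, inj₂ k = slack s_k of term t_k.

Var : ℕ → ℕ → Set
Var m K = Fin m ⊎ Fin K

∑Var : {m K : ℕ} → (Var m K → ℚ) → ℚ
∑Var f = ∑ (λ h → f (inj₁ h)) + ∑ (λ k → f (inj₂ k))

evalTerm : {m : ℕ} → (Fin m → ℚ) → (Fin m → ℚ) → ℚ
evalTerm t y = ∑ (λ h → t h * y h)

-- Kind of an input inequality: lower  l ≤ t_k,  upper  u ≥ t_k.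
data Kind : Set where
  lower upper : Kind

record Ineq (K : ℕ) : Set where
  constructor ineq
  field
    term  : Fin K
    kind  : Kind
    bound : ℚ
open Ineq public

-- The slack variable of the term of an input inequality; the corresponding
-- elementary atom is  bound ≤ slack  (lower) or  bound ≥ slack  (upper).
slackOf : {m K : ℕ} → Ineq K → Var m K
slackOf p = inj₂ (term p)

SatInitial : {m K : ℕ} → (Fin K → Fin m → ℚ) → (Var m K → ℚ) → Set
SatInitial {m} {K} t v = (k : Fin K) → v (inj₂ k) ≡ evalTerm (t k) (λ h → v (inj₁ h))

rowRHS : {m K : ℕ} → (Var m K → Bool) → (Var m K → Var m K → ℚ)
       → (Var m K → ℚ) → Var m K → ℚ
rowRHS isBasic a v i = ∑Var (λ j → if isBasic j then 0ℚ else a i j * v j)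

SatTableau : {m K : ℕ} → (Var m K → Bool) → (Var m K → Var m K → ℚ)
           → (Var m K → ℚ) → Set
SatTableau isBasic a v = ∀ i → isBasic i ≡ true → v i ≡ rowRHS isBasic a v i

record LinTerm (m : ℕ) : Set where
  constructor lt
  field
    coef  : Fin m → ℚ
    const : ℚ
open LinTerm public

_⊕_ : {m : ℕ} → LinTerm m → LinTerm m → LinTerm m
e ⊕ e' = lt (λ h → coef e h + coef e' h) (const e + const e')

_⊛_ : {m : ℕ} → ℚ → LinTerm m → LinTerm m
c ⊛ e = lt (λ h → c * coef e h) (c * const e)

∑T : {m n : ℕ} → (Fin n → LinTerm m) → LinTerm m
∑T {m} {zero}  f = lt (λ _ → 0ℚ) 0ℚ
∑T {m} {suc n} f = f zero ⊕ ∑T (λ i → f (suc i))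

∑TVar : {m K : ℕ} → (Var m K → LinTerm m) → LinTerm m
∑TVar f = ∑T (λ h → f (inj₁ h)) ⊕ ∑T (λ k → f (inj₂ k))

asNonNeg : {m K : ℕ} → (Fin K → Fin m → ℚ) → Ineq K → LinTerm m
asNonNeg t (ineq k lower l) = lt (λ h → t k h) (- l)
asNonNeg t (ineq k upper u) = lt (λ h → - t k h) u

combCoeff : {m K : ℕ} → (Var m K → Bool) → (Var m K → Var m K → ℚ)
          → Var m K → Var m K → ℚ
combCoeff isBasic a i j =
  if isBasic j then 0ℚ
  else (if does (0ℚ <? a i j) then a i j
        else (if does (a i j <? 0ℚ) then - a i j else 0ℚ))

combination : {m K n : ℕ} → (Fin K → Fin m → ℚ) → (Fin n → Ineq K)
            → (Var m K → Bool) → (Var m K → Var m K → ℚ)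
            → Var m K → Fin n → (Var m K → Fin n) → LinTerm m
combination t inp isBasic a xi pi atomOf =
  ∑TVar (λ j → combCoeff isBasic a xi j ⊛ asNonNeg t (inp (atomOf j)))
  ⊕ asNonNeg t (inp pi)

-- For each h, the assignment y = e_h, s_k = t_k(e_h) solves the initial equations, hence the
-- tableau row of x_i: the y_h-coefficient of s_i is Σ_j a_ij times that of x_j.  A chosen atom
-- scaled by its coefficient contributes a_ij·(β(x_j) − x_j) (upper atoms directly, lower atoms
-- after negating), so the y_h-coefficients cancel against the atom of x_i, and the constant is
-- Σ_j a_ij β(x_j) − l_i = β(x_i) − l_i < 0.
module Submission where

open import Defs
open import Data.Nat using (ℕ; zero; suc)
open import Data.Fin using (Fin; zero; suc)
open import Data.Bool using (Bool; true; false; if_then_else_)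
open import Data.Sum using (inj₁; inj₂)
open import Data.Product using (_×_; ∃; _,_; proj₁; proj₂)
open import Data.Rational using (ℚ; 0ℚ; 1ℚ; _<_; _+_; _*_; -_)
open import Data.Rational.Properties
open import Relation.Nullary.Decidable using (dec-true; dec-false)
open import Relation.Binary.Definitions using (tri<; tri≈; tri>)
open import Relation.Binary.PropositionalEquality
open import Function.Bundles using (_⇔_; Equivalence)
import Algebra.Properties.Group as GroupProperties

∑-cong : ∀ {n} {f g : Fin n → ℚ} → (∀ i → f i ≡ g i) → ∑ f ≡ ∑ g
∑-cong {zero}  f≡g = refl
∑-cong {suc n} f≡g = cong₂ _+_ (f≡g zero) (∑-cong (λ i → f≡g (suc i)))

∑-neg : ∀ {n} (f : Fin n → ℚ) → ∑ (λ i → - f i) ≡ - ∑ f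
∑-neg {zero}  f = refl
∑-neg {suc n} f = begin
  - f zero + ∑ (λ i → - f (suc i)) ≡⟨ cong (- f zero +_) (∑-neg (λ i → f (suc i))) ⟩
  - f zero + - ∑ (λ i → f (suc i)) ≡⟨ neg-distrib-+ (f zero) (∑ (λ i → f (suc i))) ⟨
  - ∑ f                            ∎
  where open ≡-Reasoning

∑-zero : ∀ {n} (f : Fin n → ℚ) → (∀ i → f i ≡ 0ℚ) → ∑ f ≡ 0ℚ
∑-zero {zero}  f f≡0 = refl
∑-zero {suc n} f f≡0 = cong₂ _+_ (f≡0 zero) (∑-zero _ (λ i → f≡0 (suc i)))

∑Var-cong : ∀ {m K} {f g : Var m K → ℚ} → (∀ j → f j ≡ g j) → ∑Var f ≡ ∑Var g
∑Var-cong f≡g = cong₂ _+_ (∑-cong (λ h → f≡g (inj₁ h))) (∑-cong (λ k → f≡g (inj₂ k)))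

∑Var-neg : ∀ {m K} (f : Var m K → ℚ) → ∑Var (λ j → - f j) ≡ - ∑Var f
∑Var-neg f = begin
  ∑ (λ h → - f (inj₁ h)) + ∑ (λ k → - f (inj₂ k)) ≡⟨ cong₂ _+_ (∑-neg (λ h → f (inj₁ h))) (∑-neg (λ k → f (inj₂ k))) ⟩
  - ∑ (λ h → f (inj₁ h)) + - ∑ (λ k → f (inj₂ k)) ≡⟨ neg-distrib-+ (∑ (λ h → f (inj₁ h))) (∑ (λ k → f (inj₂ k))) ⟨
  - ∑Var f                                        ∎
  where open ≡-Reasoning

coef-∑T : ∀ {m n} (f : Fin n → LinTerm m) h → coef (∑T f) h ≡ ∑ (λ i → coef (f i) h)
coef-∑T {n = zero}  f h = refl
coef-∑T {n = suc n} f h = cong (coef (f zero) h +_) (coef-∑T (λ i → f (suc i)) h)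

const-∑T : ∀ {m n} (f : Fin n → LinTerm m) → const (∑T f) ≡ ∑ (λ i → const (f i))
const-∑T {n = zero}  f = refl
const-∑T {n = suc n} f = cong (const (f zero) +_) (const-∑T (λ i → f (suc i)))

coef-∑TVar : ∀ {m K} (f : Var m K → LinTerm m) h →
             coef (∑TVar f) h ≡ ∑Var (λ j → coef (f j) h)
coef-∑TVar f h = cong₂ _+_ (coef-∑T (λ h′ → f (inj₁ h′)) h) (coef-∑T (λ k → f (inj₂ k)) h)

const-∑TVar : ∀ {m K} (f : Var m K → LinTerm m) → const (∑TVar f) ≡ ∑Var (λ j → const (f j))
const-∑TVar f = cong₂ _+_ (const-∑T (λ h → f (inj₁ h))) (const-∑T (λ k → f (inj₂ k)))

δ : ∀ {m} → Fin m → Fin m → ℚ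
δ zero    zero    = 1ℚ
δ zero    (suc _) = 0ℚ
δ (suc _) zero    = 0ℚ
δ (suc h) (suc h′) = δ h h′

∑-*δ : ∀ {m} (f : Fin m → ℚ) h → ∑ (λ h′ → f h′ * δ h h′) ≡ f h
∑-*δ {suc m} f zero = begin
  f zero * 1ℚ + ∑ (λ i → f (suc i) * 0ℚ) ≡⟨ cong₂ _+_ (*-identityʳ (f zero)) (∑-zero _ (λ i → *-zeroʳ (f (suc i)))) ⟩
  f zero + 0ℚ                            ≡⟨ +-identityʳ (f zero) ⟩
  f zero                                 ∎
  where open ≡-Reasoning
∑-*δ {suc m} f (suc h) = begin
  f zero * 0ℚ + ∑ (λ i → f (suc i) * δ h i) ≡⟨ cong₂ _+_ (*-zeroʳ (f zero)) (∑-*δ (λ i → f (suc i)) h) ⟩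
  0ℚ + f (suc h)                             ≡⟨ +-identityˡ (f (suc h)) ⟩
  f (suc h)                                  ∎
  where open ≡-Reasoning

unitSolution : ∀ {m K} → (Fin K → Fin m → ℚ) → Fin m → Var m K → ℚ
unitSolution t h (inj₁ h′) = δ h h′
unitSolution t h (inj₂ k)  = t k h

unitSolution-satInitial : ∀ {m K} (t : Fin K → Fin m → ℚ) h → SatInitial t (unitSolution t h)
unitSolution-satInitial t h k = sym (∑-*δ (t k) h)

module _ {m K : ℕ} (t : Fin K → Fin m → ℚ) where

  coef-lowerAtom : (p : Ineq K) → kind p ≡ lower → ∀ h →
                   coef (asNonNeg t p) h ≡ unitSolution t h (slackOf p)
  coef-lowerAtom (ineq k lower l) refl h = refl

  const-lowerAtom : (p : Ineq K) → kind p ≡ lower → const (asNonNeg {m} t p) ≡ - bound p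
  const-lowerAtom (ineq k lower l) refl = refl

  coef-scaledUpperAtom : (x : ℚ) (p : Ineq K) → kind p ≡ upper → ∀ h →
                         coef (x ⊛ asNonNeg t p) h ≡ - (x * unitSolution t h (slackOf p))
  coef-scaledUpperAtom x (ineq k upper u) refl h = sym (neg-distribʳ-* x (t k h))

  const-scaledUpperAtom : (x : ℚ) (p : Ineq K) → kind p ≡ upper →
                          const (x ⊛ asNonNeg {m} t p) ≡ x * bound p
  const-scaledUpperAtom x (ineq k upper u) refl = refl

  coef-scaledLowerAtom : (x : ℚ) (p : Ineq K) → kind p ≡ lower → ∀ h →
                         coef ((- x) ⊛ asNonNeg t p) h ≡ - (x * unitSolution t h (slackOf p))
  coef-scaledLowerAtom x (ineq k lower l) refl h = sym (neg-distribˡ-* x (t k h))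

  const-scaledLowerAtom : (x : ℚ) (p : Ineq K) → kind p ≡ lower →
                          const ((- x) ⊛ asNonNeg {m} t p) ≡ x * bound p
  const-scaledLowerAtom x (ineq k lower l) refl = begin
    - x * - l   ≡⟨ neg-distribˡ-* x (- l) ⟨
    - (x * - l) ≡⟨ cong -_ (neg-distribʳ-* x l) ⟨
    - - (x * l) ≡⟨ GroupProperties.⁻¹-involutive +-0-group (x * l) ⟩
    x * l       ∎
    where open ≡-Reasoning

Represents : ∀ {m} → (Fin m → ℚ) → ℚ → LinTerm m → Set
Represents r c e = (∀ h → coef e h ≡ - r h) × const e ≡ c

Represents-resp : ∀ {m} {r r′ : Fin m → ℚ} {c c′ e} → (∀ h → r h ≡ r′ h) → c ≡ c′ →
                  Represents r c e → Represents r′ c′ e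
Represents-resp r≡r′ c≡c′ (coefs , constant) =
  (λ h → trans (coefs h) (cong -_ (r≡r′ h))) , trans constant c≡c′

represents-zero : ∀ {m} (e : LinTerm m) → Represents (λ _ → 0ℚ) 0ℚ (0ℚ ⊛ e)
represents-zero e = (λ h → *-zeroˡ (coef e h)) , *-zeroˡ (const e)

Represents-∑TVar : ∀ {m K} {f : Var m K → LinTerm m} {r : Var m K → Fin m → ℚ} {c : Var m K → ℚ} →
                   (∀ j → Represents (r j) (c j) (f j)) →
                   Represents (λ h → ∑Var (λ j → r j h)) (∑Var c) (∑TVar f)
Represents-∑TVar {f = f} {r} reps =
  (λ h → trans (coef-∑TVar f h) (trans (∑Var-cong (λ j → proj₁ (reps j) h)) (∑Var-neg (λ j → r j h)))) ,
  trans (const-∑TVar f) (∑Var-cong (λ j → proj₂ (reps j)))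

module _ {m K : ℕ} (isBasic : Var m K → Bool) (a : Var m K → Var m K → ℚ) (i : Var m K) where

  rowTerm : (Var m K → ℚ) → Var m K → ℚ
  rowTerm v j = if isBasic j then 0ℚ else a i j * v j

  module _ {j : Var m K} where

    combCoeff-basic : isBasic j ≡ true → combCoeff isBasic a i j ≡ 0ℚ
    combCoeff-basic basic rewrite basic = refl

    combCoeff-pos : isBasic j ≡ false → 0ℚ < a i j → combCoeff isBasic a i j ≡ a i j
    combCoeff-pos nonbasic pos rewrite nonbasic | dec-true (0ℚ <? a i j) pos = refl

    combCoeff-neg : isBasic j ≡ false → a i j < 0ℚ → combCoeff isBasic a i j ≡ - a i j
    combCoeff-neg nonbasic neg
      rewrite nonbasic | dec-false (0ℚ <? a i j) (<-asym neg) | dec-true (a i j <? 0ℚ) neg = refl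

    combCoeff-zero : isBasic j ≡ false → a i j ≡ 0ℚ → combCoeff isBasic a i j ≡ 0ℚ
    combCoeff-zero nonbasic a≡0 rewrite nonbasic | a≡0 = refl

    rowTerm-basic : ∀ v → isBasic j ≡ true → rowTerm v j ≡ 0ℚ
    rowTerm-basic v basic rewrite basic = refl

    rowTerm-nonbasic : ∀ v → isBasic j ≡ false → rowTerm v j ≡ a i j * v j
    rowTerm-nonbasic v nonbasic rewrite nonbasic = refl

  atomContribution :
    (t : Fin K → Fin m → ℚ) (v : Var m K → ℚ) (p : Ineq K) (j : Var m K) →
    (isBasic j ≡ false → 0ℚ < a i j → slackOf p ≡ j × kind p ≡ upper × v j ≡ bound p) →
    (isBasic j ≡ false → a i j < 0ℚ → slackOf p ≡ j × kind p ≡ lower × v j ≡ bound p) →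
    Represents (λ h → rowTerm (unitSolution t h) j) (rowTerm v j) (combCoeff isBasic a i j ⊛ asNonNeg t p)
  atomContribution t v p j plus minus = byBasic (isBasic j) refl
    where
    atom : LinTerm m
    atom = asNonNeg t p

    withCoeff : ∀ {r c x} → combCoeff isBasic a i j ≡ x → Represents r c (x ⊛ atom) →
                Represents r c (combCoeff isBasic a i j ⊛ atom)
    withCoeff coeff = subst (λ x → Represents _ _ (x ⊛ atom)) (sym coeff)

    atSlack : slackOf p ≡ j → ∀ h → a i j * unitSolution t h (slackOf p) ≡ a i j * unitSolution t h j
    atSlack slack h = cong (λ s → a i j * unitSolution t h s) slack

    atValue : v j ≡ bound p → a i j * bound p ≡ a i j * v j
    atValue value = cong (a i j *_) (sym value)

    nonbasicContribution : isBasic j ≡ false →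
      Represents (λ h → a i j * unitSolution t h j) (a i j * v j) (combCoeff isBasic a i j ⊛ atom)
    nonbasicContribution nonbasic with <-cmp 0ℚ (a i j)
    ... | tri< pos _ _ with plus nonbasic pos
    ...   | slack , isUpper , value = withCoeff (combCoeff-pos nonbasic pos)
              (Represents-resp (atSlack slack) (atValue value)
                (coef-scaledUpperAtom t (a i j) p isUpper , const-scaledUpperAtom t (a i j) p isUpper))
    nonbasicContribution nonbasic | tri> _ _ neg with minus nonbasic neg
    ...   | slack , isLower , value = withCoeff (combCoeff-neg nonbasic neg)
              (Represents-resp (atSlack slack) (atValue value)
                (coef-scaledLowerAtom t (a i j) p isLower , const-scaledLowerAtom t (a i j) p isLower))
    nonbasicContribution nonbasic | tri≈ _ 0≡a _ = withCoeff (combCoeff-zero nonbasic (sym 0≡a))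
      (Represents-resp (λ h → trans (sym (*-zeroˡ (unitSolution t h j))) (cong (_* unitSolution t h j) 0≡a))
                       (trans (sym (*-zeroˡ (v j))) (cong (_* v j) 0≡a))
                       (represents-zero atom))

    byBasic : (b : Bool) → isBasic j ≡ b →
      Represents (λ h → rowTerm (unitSolution t h) j) (rowTerm v j) (combCoeff isBasic a i j ⊛ atom)
    byBasic true basic = withCoeff (combCoeff-basic basic)
      (Represents-resp (λ h → sym (rowTerm-basic (unitSolution t h) basic)) (sym (rowTerm-basic v basic)) (represents-zero atom))
    byBasic false nonbasic =
      Represents-resp (λ h → sym (rowTerm-nonbasic (unitSolution t h) nonbasic)) (sym (rowTerm-nonbasic v nonbasic))
                      (nonbasicContribution nonbasic)

mainTheorem2 : (m K n : ℕ)
    (t : Fin K → Fin m → ℚ)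
    (distinct : (k k′ : Fin K) → ((h : Fin m) → t k h ≡ t k′ h) → k ≡ k′)
    (inp : Fin n → Ineq K)
    (termsUsed : (k : Fin K) → ∃ λ p → term (inp p) ≡ k)
    (isBasic : Var m K → Bool)
    (a : Var m K → Var m K → ℚ)
    (sameSolutions : (v : Var m K → ℚ) → SatInitial t v ⇔ SatTableau isBasic a v)
    (β : Var m K → ℚ)
    (βrows : SatTableau isBasic a β)
    (xi : Var m K) (xiBasic : isBasic xi ≡ true)
    (pi : Fin n)
    (piAtom : slackOf (inp pi) ≡ xi × kind (inp pi) ≡ lower)
    (conflict : β xi < bound (inp pi))
    (atomOf : Var m K → Fin n)
    (atomPlus : (j : Var m K) → isBasic j ≡ false → 0ℚ < a xi j →
       slackOf (inp (atomOf j)) ≡ j × kind (inp (atomOf j)) ≡ upper × β j ≡ bound (inp (atomOf j)))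
    (atomMinus : (j : Var m K) → isBasic j ≡ false → a xi j < 0ℚ →
       slackOf (inp (atomOf j)) ≡ j × kind (inp (atomOf j)) ≡ lower × β j ≡ bound (inp (atomOf j))) →
    let c = combination t inp isBasic a xi pi atomOf in
    ((h : Fin m) → coef c h ≡ 0ℚ) × const c < 0ℚ
mainTheorem2 m K n t _ inp _ isBasic a sameSolutions β βrows xi xiBasic pi (slack , isLower) conflict atomOf atomPlus atomMinus =
  coefs-vanish , const-negative
  where
  open ≡-Reasoning
  contribution : Var m K → LinTerm m
  contribution j = combCoeff isBasic a xi j ⊛ asNonNeg t (inp (atomOf j))

  combined : Represents (λ h → rowRHS isBasic a (unitSolution t h) xi) (rowRHS isBasic a β xi)
                        (∑TVar contribution)
  combined = Represents-∑TVar (λ j →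
    atomContribution isBasic a xi t β (inp (atomOf j)) j (atomPlus j) (atomMinus j))

  unitRow : ∀ h → unitSolution t h xi ≡ rowRHS isBasic a (unitSolution t h) xi
  unitRow h = Equivalence.to (sameSolutions (unitSolution t h)) (unitSolution-satInitial t h) xi xiBasic

  coefs-vanish : ∀ h → coef (combination t inp isBasic a xi pi atomOf) h ≡ 0ℚ
  coefs-vanish h = begin
    coef (∑TVar contribution) h + coef (asNonNeg t (inp pi)) h
      ≡⟨ cong₂ _+_ (proj₁ combined h) (coef-lowerAtom t (inp pi) isLower h) ⟩
    - rowRHS isBasic a (unitSolution t h) xi + unitSolution t h (slackOf (inp pi))
      ≡⟨ cong (λ x → - rowRHS isBasic a (unitSolution t h) xi + unitSolution t h x) slack ⟩
    - rowRHS isBasic a (unitSolution t h) xi + unitSolution t h xi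
      ≡⟨ cong (- rowRHS isBasic a (unitSolution t h) xi +_) (unitRow h) ⟩
    - rowRHS isBasic a (unitSolution t h) xi + rowRHS isBasic a (unitSolution t h) xi
      ≡⟨ +-inverseˡ (rowRHS isBasic a (unitSolution t h) xi) ⟩
    0ℚ ∎

  const≡gap : const (combination t inp isBasic a xi pi atomOf) ≡ β xi + - bound (inp pi)
  const≡gap = begin
    const (∑TVar contribution) + const (asNonNeg t (inp pi))
      ≡⟨ cong₂ _+_ (proj₂ combined) (const-lowerAtom t (inp pi) isLower) ⟩
    rowRHS isBasic a β xi + - bound (inp pi)
      ≡⟨ cong (_+ - bound (inp pi)) (βrows xi xiBasic) ⟨
    β xi + - bound (inp pi) ∎

  const-negative : const (combination t inp isBasic a xi pi atomOf) < 0ℚ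
  const-negative = <-respˡ-≡ (sym const≡gap)
    (<-respʳ-≡ (+-inverseʳ (bound (inp pi))) (+-monoˡ-< (- bound (inp pi)) conflict))
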